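{- Let $G_1$ be an $r_1$-regular graph with $n_1$ vertices $v_1,\dots,v_{n_1}$ and $m_1$ edges, and let $G_2$ be an arbitrary graph with $n_2\ge 1$ vertices $w_1,\dots,w_{n_2}$. Let $G_1\circ G_2$ be the corona of $G_1$ and $G_2$, with its vertices ordered as $v_1,\dots,v_{n_1}$, followed by $W_1, W_2,\dots,W_{n_2}$, where $W_j=(w^1_j,w^2_j,\dots,w^{n_1}_j)$. Define $$L_1=L(G_1)+n_2I_{n_1},\qquad L_2=-\mathbf{1}^T_{n_2}\otimes I_{n_1},\qquad L_3=(L(G_2)+I_{n_2})\otimes I_{n_1},\qquad S=L_3-J_{n_2\times n_2}\otimes L_1^{ -1}.$$ Then, with respect to this vertex ordering, the matrix $$\begin{pmatrix} L_1^{ -1}+L_1^{ -1}L_2S^{\#}L_2^TL_1^{ -1} & -L_1^{ -1}L_2S^{\#}\\ -S^{\#}L_2^TL_1^{ -1} & S^{\#}\end{pmatrix}$$ is a symmetric $\{1\}$-inverse of the Laplacian matrix $L(G_1\circ G_2)$.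
   Context: All graphs are simple and undirected. For a graph $G$, $A(G)$ is its adjacency matrix, $D(G)$ the diagonal matrix of vertex degrees, and $L(G)=D(G)-A(G)$ its Laplacian matrix. The corona $G_1\circ G_2$ of graphs $G_1$ (on $n_1$ vertices) and $G_2$ (on $n_2$ vertices) is the graph formed from one copy of $G_1$ and $n_1$ copies of $G_2$, where the $i$-th vertex $v_i$ of $G_1$ is joined to every vertex of the $i$-th copy of $G_2$; $w^i_j$ denotes the copy of $w_j$ in the $i$-th copy of $G_2$. $\mathbf{1}_n$ is the all-ones column vector of length $n$, $J_{n\times n}$ the all-ones $n\times n$ matrix, $I_n$ the identity matrix, and $\otimes$ the Kronecker product ($A\otimes B$ is obtained from $A$ by replacing each entry $a_{ij}$ by the block $a_{ij}B$). A matrix $X$ is a $\{1\}$-inverse of $A$ if $AXA=A$. For a square matrix $S$, the group inverse $S^{\#}$ is the unique matrix $X$ with $SXS=S$, $XSX=X$, $SX=XS$ (for real symmetric $S$ it exists and equals the Moore–Penrose inverse). -}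

module Defs where

open import Data.Nat using (ℕ; zero; suc) renaming (_+_ to _+ℕ_; _*_ to _*ℕ_)
open import Data.Bool using (Bool; true; false; if_then_else_)
open import Data.Fin using (Fin; zero; suc; splitAt; remQuot; _≟_)
open import Data.Sum using (_⊎_; inj₁; inj₂)
open import Data.Product using (_×_; _,_)
open import Data.Rational using (ℚ; 0ℚ; 1ℚ; _+_; _*_; -_)
open import Relation.Nullary using (does)
open import Relation.Binary.PropositionalEquality using (_≡_)
open import Data.Bool using (_∧_)

record Graph (n : ℕ) : Set where
  field
    adj   : Fin n → Fin n → Bool
    sym   : ∀ i j → adj i j ≡ adj j i
    irrefl : ∀ i → adj i i ≡ false
open Graph public

count : ∀ {n} → (Fin n → Bool) → ℕ
count {zero}  f = zero
count {suc n} f = (if f zero then 1 else 0) +ℕ count (λ i → f (suc i))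

degree : ∀ {n} → Graph n → Fin n → ℕ
degree G i = count (adj G i)

Regular : ∀ {n} → Graph n → ℕ → Set
Regular G r = ∀ i → degree G i ≡ r

-- number of edges: number of adjacent pairs (i , j) with i < j,
-- computed recursively (edges among the later vertices plus
-- edges from vertex zero)
numEdges : ∀ {n} → Graph n → ℕ
numEdges {n} G = go (adj G)
  where
  go : ∀ {k} → (Fin k → Fin k → Bool) → ℕ
  go {zero}  a = zero
  go {suc k} a = count (λ j → a zero (suc j)) +ℕ go (λ i j → a (suc i) (suc j))

Mat : ℕ → ℕ → Set
Mat m n = Fin m → Fin n → ℚ

sumF : ∀ {n} → (Fin n → ℚ) → ℚ
sumF {zero}  f = 0ℚ
sumF {suc n} f = f zero + sumF (λ i → f (suc i))

_·_ : ∀ {m n p} → Mat m n → Mat n p → Mat m p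
(A · B) i k = sumF (λ j → A i j * B j k)
infixl 7 _·_

_⊕_ : ∀ {m n} → Mat m n → Mat m n → Mat m n
(A ⊕ B) i j = A i j + B i j
infixl 6 _⊕_

_⊖_ : ∀ {m n} → Mat m n → Mat m n → Mat m n
(A ⊖ B) i j = A i j + (- B i j)
infixl 6 _⊖_

neg : ∀ {m n} → Mat m n → Mat m n
neg A i j = - A i j

transpose : ∀ {m n} → Mat m n → Mat n m
transpose A i j = A j i

scal : ∀ {m n} → ℚ → Mat m n → Mat m n
scal c A i j = c * A i j

identity : ∀ n → Mat n n
identity n i j = if does (i ≟ j) then 1ℚ else 0ℚ

ones : ∀ m n → Mat m n
ones m n i j = 1ℚ

-- Kronecker product; row index of A ⊗ B is combine i k ≅ i * c + k
_⊗_ : ∀ {a b c d} → Mat a b → Mat c d → Mat (a *ℕ c) (b *ℕ d)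
_⊗_ {a} {b} {c} {d} A B x y with remQuot {a} c x | remQuot {b} d y
... | i , k | j , l = A i j * B k l
infixl 8 _⊗_

block : ∀ {m n} → Mat m m → Mat m n → Mat n m → Mat n n → Mat (m +ℕ n) (m +ℕ n)
block {m} {n} P Q R T x y with splitAt m x | splitAt m y
... | inj₁ i | inj₁ j = P i j
... | inj₁ i | inj₂ j = Q i j
... | inj₂ i | inj₁ j = R i j
... | inj₂ i | inj₂ j = T i j

Symmetric : ∀ {n} → Mat n n → Set
Symmetric A = ∀ i j → A i j ≡ A j i

Is1Inverse : ∀ {m n} → Mat n m → Mat m n → Set
Is1Inverse X A = ∀ i j → (A · X · A) i j ≡ A i j

IsGroupInverse : ∀ {n} → Mat n n → Mat n n → Set
IsGroupInverse X S =
  (∀ i j → (S · X · S) i j ≡ S i j) ×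
  (∀ i j → (X · S · X) i j ≡ X i j) ×
  (∀ i j → (S · X) i j ≡ (X · S) i j)

IsInverse : ∀ {n} → Mat n n → Mat n n → Set
IsInverse X A = (∀ i j → (A · X) i j ≡ identity _ i j) × (∀ i j → (X · A) i j ≡ identity _ i j)

fromBool : Bool → ℚ
fromBool true  = 1ℚ
fromBool false = 0ℚ

natℚ : ℕ → ℚ
natℚ zero    = 0ℚ
natℚ (suc k) = 1ℚ + natℚ k

lapRel : ∀ {n} → (Fin n → Fin n → Bool) → Mat n n
lapRel a i j = (if does (i ≟ j) then natℚ (count (a i)) else 0ℚ) + (- fromBool (a i j))

laplacian : ∀ {n} → Graph n → Mat n n
laplacian G = lapRel (adj G)

-- Corona G₁ ∘ G₂ on Fin (n₁ + n₂ * n₁):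
-- index i (from splitAt n₁ as inj₁ i) is v_{i};
-- index n₁ + j * n₁ + i (remQuot gives (j , i)) is w^{i}_{j},
-- so the vertices are v₁..v_{n₁}, W₁, …, W_{n₂}, W_j = (w^1_j, …, w^{n₁}_j).

data CVertex (n₁ n₂ : ℕ) : Set where
  vtx : Fin n₁ → CVertex n₁ n₂
  wtx : Fin n₂ → Fin n₁ → CVertex n₁ n₂   -- wtx j i = w^i_j

decode : ∀ {n₁ n₂} → Fin (n₁ +ℕ n₂ *ℕ n₁) → CVertex n₁ n₂
decode {n₁} {n₂} x with splitAt n₁ x
... | inj₁ i = vtx i
... | inj₂ y with remQuot {n₂} n₁ y
...   | j , i = wtx j i

coronaAdj : ∀ {n₁ n₂} → Graph n₁ → Graph n₂ → CVertex n₁ n₂ → CVertex n₁ n₂ → Bool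
coronaAdj G₁ G₂ (vtx a)   (vtx b)   = adj G₁ a b
coronaAdj G₁ G₂ (vtx a)   (wtx j i) = does (a ≟ i)
coronaAdj G₁ G₂ (wtx j i) (vtx a)   = does (i ≟ a)
coronaAdj G₁ G₂ (wtx j i) (wtx l k) = does (i ≟ k) ∧ adj G₂ j l

coronaRel : ∀ {n₁ n₂} → Graph n₁ → Graph n₂ →
            Fin (n₁ +ℕ n₂ *ℕ n₁) → Fin (n₁ +ℕ n₂ *ℕ n₁) → Bool
coronaRel G₁ G₂ x y = coronaAdj G₁ G₂ (decode x) (decode y)

coronaLaplacian : ∀ {n₁ n₂} → Graph n₁ → Graph n₂ → Mat (n₁ +ℕ n₂ *ℕ n₁) (n₁ +ℕ n₂ *ℕ n₁)
coronaLaplacian G₁ G₂ = lapRel (coronaRel G₁ G₂)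

-- Kronecker product of a row vector uᵀ (1 × b) with a c × d matrix B,
-- viewed as a c × (b * d) matrix (identifying 1 * c with c)
_⊗ʳ_ : ∀ {b c d} → (Fin b → ℚ) → Mat c d → Mat c (b *ℕ d)
_⊗ʳ_ {b} {c} {d} u B k y with remQuot {b} d y
... | j , l = u j * B k l
infixl 8 _⊗ʳ_

onesVec : ∀ n → Fin n → ℚ
onesVec n i = 1ℚ

module Submission where

-- In the vertex order v, W₁, …, W_{n₂} the Laplacian of G₁ ∘ G₂ is the block matrix
-- [[L₁, L₂], [L₂ᵀ, L₃]], and L₂ᵀ L₁⁻¹ L₂ = J ⊗ L₁⁻¹, so S is the Schur complement of the
-- invertible block L₁. For any block matrix [[A, B], [C, D]] with A invertible and any S⁻
-- with S S⁻ S = S, where S = D − C A⁻¹ B, multiplying out shows that the displayed matrix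
-- is a {1}-inverse. It is symmetric because A⁻¹ is, and because the group inverse of the
-- symmetric S is: its transpose is again a group inverse of S, and group inverses are unique.

open import Algebra.Bundles using (CommutativeRing)
open import Data.Bool using (Bool; true; false; if_then_else_; _∧_)
open import Data.Empty using (⊥-elim)
open import Data.Fin using (Fin; zero; suc; splitAt; remQuot; _≟_; _↑ˡ_; _↑ʳ_; combine; join)
open import Data.Fin.Properties
  using (splitAt-↑ˡ; splitAt-↑ʳ; join-splitAt; remQuot-combine; combine-remQuot;
         ↑ˡ-injective; ↑ʳ-injective; combine-injective)
open import Data.Nat using (ℕ; zero; suc; _≤_) renaming (_+_ to _+ℕ_; _*_ to _*ℕ_)
open import Data.Product using (_×_; _,_; proj₁; proj₂)
open import Data.Rational using (ℚ; 0ℚ; 1ℚ; _+_; _*_; -_)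
open import Data.Rational.Properties
  using (+-*-commutativeRing; +-identityˡ; +-identityʳ; +-assoc; *-comm; *-assoc;
         *-identityˡ; *-identityʳ; *-zeroˡ; *-distribˡ-+; *-distribʳ-+;
         neg-distrib-+; neg-distribˡ-*; neg-distribʳ-*)
open import Data.Rational.Solver using (module +-*-Solver)
open import Data.Sum using (_⊎_; inj₁; inj₂)
open import Function using (_∘_; mk⇔)
open import Level using (0ℓ)
open import Relation.Binary.Bundles using (Setoid)
import Relation.Binary.Reasoning.Setoid as SetoidReasoning
open import Relation.Binary.PropositionalEquality
open import Relation.Nullary using (does; yes; no; _×-dec_)
open import Relation.Nullary.Decidable using (does-⇔; dec-false)

open import Defs hiding (sym)
open import Algebra.Properties.Semiring.Sum (CommutativeRing.semiring +-*-commutativeRing)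
  using (sum; sum-cong-≗; ∑-comm; ∑-distrib-+; *-distribˡ-sum; sum-replicate-zero)
open +-*-Solver

sumF≡sum : ∀ {n} (f : Fin n → ℚ) → sumF f ≡ sum f
sumF≡sum {zero}  f = refl
sumF≡sum {suc n} f = cong (f zero +_) (sumF≡sum (f ∘ suc))

sumF-cong : ∀ {n} {f g : Fin n → ℚ} → (∀ i → f i ≡ g i) → sumF f ≡ sumF g
sumF-cong {zero}  e = refl
sumF-cong {suc n} e = cong₂ _+_ (e zero) (sumF-cong (e ∘ suc))

sumF-zero : ∀ n → sumF {n} (λ _ → 0ℚ) ≡ 0ℚ
sumF-zero n = trans (sumF≡sum {n} (λ _ → 0ℚ)) (sum-replicate-zero n)

sumF-distrib-+ : ∀ {n} (f g : Fin n → ℚ) → sumF (λ i → f i + g i) ≡ sumF f + sumF g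
sumF-distrib-+ f g = begin
  sumF (λ i → f i + g i) ≡⟨ sumF≡sum (λ i → f i + g i) ⟩
  sum (λ i → f i + g i)  ≡⟨ ∑-distrib-+ f g ⟩
  sum f + sum g          ≡⟨ cong₂ _+_ (sumF≡sum f) (sumF≡sum g) ⟨
  sumF f + sumF g        ∎
  where open ≡-Reasoning

*-distribˡ-sumF : ∀ {n} (c : ℚ) (f : Fin n → ℚ) → c * sumF f ≡ sumF (λ i → c * f i)
*-distribˡ-sumF c f = begin
  c * sumF f             ≡⟨ cong (c *_) (sumF≡sum f) ⟩
  c * sum f              ≡⟨ *-distribˡ-sum c f ⟩
  sum (λ i → c * f i)    ≡⟨ sumF≡sum (λ i → c * f i) ⟨
  sumF (λ i → c * f i)   ∎
  where open ≡-Reasoning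

*-distribʳ-sumF : ∀ {n} (c : ℚ) (f : Fin n → ℚ) → sumF f * c ≡ sumF (λ i → f i * c)
*-distribʳ-sumF c f = begin
  sumF f * c             ≡⟨ *-comm (sumF f) c ⟩
  c * sumF f             ≡⟨ *-distribˡ-sumF c f ⟩
  sumF (λ i → c * f i)   ≡⟨ sumF-cong (λ i → *-comm c (f i)) ⟩
  sumF (λ i → f i * c)   ∎
  where open ≡-Reasoning

neg-distrib-sumF : ∀ {n} (f : Fin n → ℚ) → - sumF f ≡ sumF (λ i → - f i)
neg-distrib-sumF {zero}  f = refl
neg-distrib-sumF {suc n} f =
  trans (neg-distrib-+ (f zero) _) (cong (- f zero +_) (neg-distrib-sumF (f ∘ suc)))

sumF-comm : ∀ {m n} (f : Fin m → Fin n → ℚ) →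
            sumF (λ i → sumF (f i)) ≡ sumF (λ j → sumF (λ i → f i j))
sumF-comm f = begin
  sumF (λ i → sumF (f i))           ≡⟨ sumF²≡sum² f ⟩
  sum (λ i → sum (f i))             ≡⟨ ∑-comm f ⟩
  sum (λ j → sum (λ i → f i j))     ≡⟨ sumF²≡sum² (λ j i → f i j) ⟨
  sumF (λ j → sumF (λ i → f i j))   ∎
  where
  open ≡-Reasoning
  sumF²≡sum² : ∀ {m n} (g : Fin m → Fin n → ℚ) → sumF (λ i → sumF (g i)) ≡ sum (λ i → sum (g i))
  sumF²≡sum² g = trans (sumF≡sum (λ i → sumF (g i))) (sum-cong-≗ (λ i → sumF≡sum (g i)))

sumF-↑ : ∀ {m n} (f : Fin (m +ℕ n) → ℚ) →
         sumF f ≡ sumF (λ i → f (i ↑ˡ n)) + sumF (λ j → f (m ↑ʳ j))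
sumF-↑ {zero}      f = sym (+-identityˡ (sumF f))
sumF-↑ {suc m} {n} f =
  trans (cong (f zero +_) (sumF-↑ {m} (f ∘ suc)))
        (sym (+-assoc (f zero) (sumF (λ i → f (suc (i ↑ˡ n)))) _))

sumF-combine : ∀ {m n} (f : Fin (m *ℕ n) → ℚ) →
               sumF f ≡ sumF (λ i → sumF (λ k → f (combine {m} {n} i k)))
sumF-combine {zero}      f = refl
sumF-combine {suc m} {n} f =
  trans (sumF-↑ {n} f) (cong (sumF (λ k → f (k ↑ˡ (m *ℕ n))) +_) (sumF-combine {m} (f ∘ (n ↑ʳ_))))

does-≟-sym : ∀ {n} (i j : Fin n) → does (i ≟ j) ≡ does (j ≟ i)
does-≟-sym i j = does-⇔ (mk⇔ sym sym) (i ≟ j) (j ≟ i)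

identity-sym : ∀ {n} (i j : Fin n) → identity n i j ≡ identity n j i
identity-sym i j = cong (λ b → if b then 1ℚ else 0ℚ) (does-≟-sym i j)

sumF-identityˡ : ∀ {n} (i : Fin n) (f : Fin n → ℚ) → sumF (λ j → identity n i j * f j) ≡ f i
sumF-identityˡ {suc n} zero f =
  trans (cong₂ _+_ (*-identityˡ (f zero)) (trans (sumF-cong (λ j → *-zeroˡ (f (suc j)))) (sumF-zero n)))
        (+-identityʳ (f zero))
sumF-identityˡ {suc n} (suc i) f =
  trans (cong (_+ sumF (λ j → identity n i j * f (suc j))) (*-zeroˡ (f zero)))
        (trans (+-identityˡ _) (sumF-identityˡ i (f ∘ suc)))

sumF-identityʳ : ∀ {n} (i : Fin n) (f : Fin n → ℚ) → sumF (λ j → f j * identity n j i) ≡ f i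
sumF-identityʳ i f =
  trans (sumF-cong (λ j → trans (*-comm (f j) _) (cong (_* f j) (identity-sym j i)))) (sumF-identityˡ i f)

infix 4 _≈_
_≈_ : ∀ {m n} → Mat m n → Mat m n → Set
A ≈ B = ∀ i j → A i j ≡ B i j

≈-setoid : ℕ → ℕ → Setoid 0ℓ 0ℓ
≈-setoid m n = record
  { Carrier       = Mat m n
  ; _≈_           = _≈_
  ; isEquivalence = record
    { refl  = λ _ _ → refl
    ; sym   = λ e i j → sym (e i j)
    ; trans = λ e f i j → trans (e i j) (f i j)
    }
  }

module ≈-Reasoning {m n : ℕ} = SetoidReasoning (≈-setoid m n)

module _ {m n : ℕ} where
  open Setoid (≈-setoid m n) public using () renaming (refl to ≈-refl; sym to ≈-sym; trans to ≈-trans)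

zeros : ∀ m n → Mat m n
zeros m n _ _ = 0ℚ

⊕-cong : ∀ {m n} {A A′ B B′ : Mat m n} → A ≈ A′ → B ≈ B′ → A ⊕ B ≈ A′ ⊕ B′
⊕-cong e f i j = cong₂ _+_ (e i j) (f i j)

⊖-cong : ∀ {m n} {A A′ B B′ : Mat m n} → A ≈ A′ → B ≈ B′ → A ⊖ B ≈ A′ ⊖ B′
⊖-cong e f i j = cong₂ (λ x y → x + - y) (e i j) (f i j)

⊕-congˡ : ∀ {m n} (A : Mat m n) {B B′ : Mat m n} → B ≈ B′ → A ⊕ B ≈ A ⊕ B′
⊕-congˡ A = ⊕-cong {A = A} ≈-refl

⊕-congʳ : ∀ {m n} (B : Mat m n) {A A′ : Mat m n} → A ≈ A′ → A ⊕ B ≈ A′ ⊕ B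
⊕-congʳ B e = ⊕-cong {B = B} e ≈-refl

⊖-congˡ : ∀ {m n} (A : Mat m n) {B B′ : Mat m n} → B ≈ B′ → A ⊖ B ≈ A ⊖ B′
⊖-congˡ A = ⊖-cong {A = A} ≈-refl

⊖-congʳ : ∀ {m n} (B : Mat m n) {A A′ : Mat m n} → A ≈ A′ → A ⊖ B ≈ A′ ⊖ B
⊖-congʳ B e = ⊖-cong {B = B} e ≈-refl

neg-cong : ∀ {m n} {A A′ : Mat m n} → A ≈ A′ → neg A ≈ neg A′
neg-cong e i j = cong -_ (e i j)

⊕-identityʳ : ∀ {m n} (A : Mat m n) → A ⊕ zeros m n ≈ A
⊕-identityʳ A i j = +-identityʳ (A i j)

·-cong : ∀ {m n p} {A A′ : Mat m n} {B B′ : Mat n p} → A ≈ A′ → B ≈ B′ → A · B ≈ A′ · B′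
·-cong e f i k = sumF-cong (λ j → cong₂ _*_ (e i j) (f j k))

·-congˡ : ∀ {m n p} (A : Mat m n) {B B′ : Mat n p} → B ≈ B′ → A · B ≈ A · B′
·-congˡ A = ·-cong {A = A} ≈-refl

·-congʳ : ∀ {m n p} (B : Mat n p) {A A′ : Mat m n} → A ≈ A′ → A · B ≈ A′ · B
·-congʳ B e = ·-cong {B = B} e ≈-refl

·-assoc : ∀ {m n p q} (A : Mat m n) (B : Mat n p) (C : Mat p q) → A · B · C ≈ A · (B · C)
·-assoc A B C i l = begin
  sumF (λ k → sumF (λ j → A i j * B j k) * C k l)   ≡⟨ sumF-cong (λ k → *-distribʳ-sumF (C k l) (λ j → A i j * B j k)) ⟩
  sumF (λ k → sumF (λ j → A i j * B j k * C k l))   ≡⟨ sumF-comm (λ k j → A i j * B j k * C k l) ⟩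
  sumF (λ j → sumF (λ k → A i j * B j k * C k l))   ≡⟨ sumF-cong (λ j → sumF-cong (λ k → *-assoc (A i j) (B j k) (C k l))) ⟩
  sumF (λ j → sumF (λ k → A i j * (B j k * C k l))) ≡⟨ sumF-cong (λ j → *-distribˡ-sumF (A i j) (λ k → B j k * C k l)) ⟨
  sumF (λ j → A i j * sumF (λ k → B j k * C k l))   ∎
  where open ≡-Reasoning

·-distribˡ-⊕ : ∀ {m n p} (A : Mat m n) (B C : Mat n p) → A · (B ⊕ C) ≈ A · B ⊕ A · C
·-distribˡ-⊕ A B C i k =
  trans (sumF-cong (λ j → *-distribˡ-+ (A i j) (B j k) (C j k))) (sumF-distrib-+ (λ j → A i j * B j k) (λ j → A i j * C j k))

·-distribʳ-⊕ : ∀ {m n p} (A B : Mat m n) (C : Mat n p) → (A ⊕ B) · C ≈ A · C ⊕ B · C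
·-distribʳ-⊕ A B C i k =
  trans (sumF-cong (λ j → *-distribʳ-+ (C j k) (A i j) (B i j))) (sumF-distrib-+ (λ j → A i j * C j k) (λ j → B i j * C j k))

neg-distribˡ-· : ∀ {m n p} (A : Mat m n) (B : Mat n p) → neg (A · B) ≈ neg A · B
neg-distribˡ-· A B i k =
  trans (neg-distrib-sumF (λ j → A i j * B j k)) (sumF-cong (λ j → neg-distribˡ-* (A i j) (B j k)))

neg-distribʳ-· : ∀ {m n p} (A : Mat m n) (B : Mat n p) → neg (A · B) ≈ A · neg B
neg-distribʳ-· A B i k =
  trans (neg-distrib-sumF (λ j → A i j * B j k)) (sumF-cong (λ j → neg-distribʳ-* (A i j) (B j k)))

·-distribˡ-⊖ : ∀ {m n p} (A : Mat m n) (B C : Mat n p) → A · (B ⊖ C) ≈ A · B ⊖ A · C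
·-distribˡ-⊖ A B C = ≈-trans (·-distribˡ-⊕ A B (neg C)) (⊕-congˡ (A · B) (≈-sym (neg-distribʳ-· A C)))

·-distribʳ-⊖ : ∀ {m n p} (A B : Mat m n) (C : Mat n p) → (A ⊖ B) · C ≈ A · C ⊖ B · C
·-distribʳ-⊖ A B C = ≈-trans (·-distribʳ-⊕ A (neg B) C) (⊕-congˡ (A · C) (≈-sym (neg-distribˡ-· B C)))

·-identityˡ : ∀ {m n} (A : Mat m n) → identity m · A ≈ A
·-identityˡ A i k = sumF-identityˡ i (λ j → A j k)

·-identityʳ : ∀ {m n} (A : Mat m n) → A · identity n ≈ A
·-identityʳ A i k = sumF-identityʳ k (λ j → A i j)

·-zeroˡ : ∀ {m n p} (A : Mat n p) → zeros m n · A ≈ zeros m p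
·-zeroˡ {n = n} A i k = trans (sumF-cong (λ j → *-zeroˡ (A j k))) (sumF-zero n)

transpose-· : ∀ {m n p} (A : Mat m n) (B : Mat n p) → transpose (A · B) ≈ transpose B · transpose A
transpose-· A B i k = sumF-cong (λ j → *-comm (A k j) (B j i))

transpose-identity : ∀ n → transpose (identity n) ≈ identity n
transpose-identity n i j = identity-sym j i

module _ {m n : ℕ} where

  ⊕-⊖-cancelʳ : (X Y : Mat m n) → X ⊕ Y ⊖ Y ≈ X
  ⊕-⊖-cancelʳ X Y i j = solve 2 (λ x y → x :+ y :- y := x) refl (X i j) (Y i j)

  ⊖-⊕-cancelʳ : (X Y : Mat m n) → X ⊖ Y ⊕ Y ≈ X
  ⊖-⊕-cancelʳ X Y i j = solve 2 (λ x y → x :- y :+ y := x) refl (X i j) (Y i j)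

  ⊕-⊖-cancelˡ : (X Y : Mat m n) → X ⊕ (Y ⊖ X) ≈ Y
  ⊕-⊖-cancelˡ X Y i j = solve 2 (λ x y → x :+ (y :- x) := y) refl (X i j) (Y i j)

  neg-inverseˡ : (X : Mat m n) → neg X ⊕ X ≈ zeros m n
  neg-inverseˡ X i j = solve 1 (λ x → :- x :+ x := con 0ℚ) refl (X i j)

  neg-⊕-comm : (X Y : Mat m n) → neg X ⊕ Y ≈ Y ⊖ X
  neg-⊕-comm X Y i j = solve 2 (λ x y → :- x :+ y := y :- x) refl (X i j) (Y i j)

  ⊕-⊖-assoc : (X Y Z : Mat m n) → X ⊕ Y ⊖ Z ≈ X ⊖ (Z ⊖ Y)
  ⊕-⊖-assoc X Y Z i j = solve 3 (λ x y z → x :+ y :- z := x :- (z :- y)) refl (X i j) (Y i j) (Z i j)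

  ⊖-⊕-assoc : (X Y Z : Mat m n) → X ⊖ Y ⊕ Z ≈ X ⊕ (Z ⊖ Y)
  ⊖-⊕-assoc X Y Z i j = solve 3 (λ x y z → x :- y :+ z := x :+ (z :- y)) refl (X i j) (Y i j) (Z i j)

-- Block matrices

↑-elim : ∀ {m n} {P : Fin (m +ℕ n) → Set} → (∀ i → P (i ↑ˡ n)) → (∀ j → P (m ↑ʳ j)) → ∀ x → P x
↑-elim {m} {n} {P} left right x = subst P (join-splitAt m n x) (by-cases (splitAt m x))
  where
  by-cases : (s : Fin m ⊎ Fin n) → P (join m n s)
  by-cases (inj₁ i) = left i
  by-cases (inj₂ j) = right j

combine-elim : ∀ {m n} {P : Fin (m *ℕ n) → Set} → (∀ i k → P (combine {m} {n} i k)) → ∀ x → P x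
combine-elim {m} {n} {P} h x =
  subst P (combine-remQuot {m} n x) (h (proj₁ (remQuot {m} n x)) (proj₂ (remQuot {m} n x)))

module _ {m n : ℕ} (P : Mat m m) (Q : Mat m n) (R : Mat n m) (T : Mat n n) where

  block-₁₁ : ∀ i j → block P Q R T (i ↑ˡ n) (j ↑ˡ n) ≡ P i j
  block-₁₁ i j rewrite splitAt-↑ˡ m i n | splitAt-↑ˡ m j n = refl

  block-₁₂ : ∀ i j → block P Q R T (i ↑ˡ n) (m ↑ʳ j) ≡ Q i j
  block-₁₂ i j rewrite splitAt-↑ˡ m i n | splitAt-↑ʳ m n j = refl

  block-₂₁ : ∀ i j → block P Q R T (m ↑ʳ i) (j ↑ˡ n) ≡ R i j
  block-₂₁ i j rewrite splitAt-↑ʳ m n i | splitAt-↑ˡ m j n = refl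

  block-₂₂ : ∀ i j → block P Q R T (m ↑ʳ i) (m ↑ʳ j) ≡ T i j
  block-₂₂ i j rewrite splitAt-↑ʳ m n i | splitAt-↑ʳ m n j = refl

  ≈-block : ∀ {X : Mat (m +ℕ n) (m +ℕ n)} →
            (∀ i j → X (i ↑ˡ n) (j ↑ˡ n) ≡ P i j) → (∀ i j → X (i ↑ˡ n) (m ↑ʳ j) ≡ Q i j) →
            (∀ i j → X (m ↑ʳ i) (j ↑ˡ n) ≡ R i j) → (∀ i j → X (m ↑ʳ i) (m ↑ʳ j) ≡ T i j) →
            X ≈ block P Q R T
  ≈-block e₁₁ e₁₂ e₂₁ e₂₂ =
    ↑-elim (λ i → ↑-elim (λ j → trans (e₁₁ i j) (sym (block-₁₁ i j)))
                         (λ j → trans (e₁₂ i j) (sym (block-₁₂ i j))))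
           (λ i → ↑-elim (λ j → trans (e₂₁ i j) (sym (block-₂₁ i j)))
                         (λ j → trans (e₂₂ i j) (sym (block-₂₂ i j))))

block-cong : ∀ {m n} {P P′ : Mat m m} {Q Q′ : Mat m n} {R R′ : Mat n m} {T T′ : Mat n n} →
             P ≈ P′ → Q ≈ Q′ → R ≈ R′ → T ≈ T′ → block P Q R T ≈ block P′ Q′ R′ T′
block-cong {P = P} {P′} {Q} {Q′} {R} {R′} {T} {T′} e₁₁ e₁₂ e₂₁ e₂₂ = ≈-block P′ Q′ R′ T′
  (λ i j → trans (block-₁₁ P Q R T i j) (e₁₁ i j)) (λ i j → trans (block-₁₂ P Q R T i j) (e₁₂ i j))
  (λ i j → trans (block-₂₁ P Q R T i j) (e₂₁ i j)) (λ i j → trans (block-₂₂ P Q R T i j) (e₂₂ i j))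

transpose-block : ∀ {m n} (P : Mat m m) (Q : Mat m n) (R : Mat n m) (T : Mat n n) →
  transpose (block P Q R T) ≈ block (transpose P) (transpose R) (transpose Q) (transpose T)
transpose-block P Q R T = ≈-block _ _ _ _
  (λ i j → block-₁₁ P Q R T j i) (λ i j → block-₂₁ P Q R T j i)
  (λ i j → block-₁₂ P Q R T j i) (λ i j → block-₂₂ P Q R T j i)

block-· : ∀ {m n} (P : Mat m m) (Q : Mat m n) (R : Mat n m) (T : Mat n n)
                  (P′ : Mat m m) (Q′ : Mat m n) (R′ : Mat n m) (T′ : Mat n n) →
  block P Q R T · block P′ Q′ R′ T′ ≈
  block (P · P′ ⊕ Q · R′) (P · Q′ ⊕ Q · T′) (R · P′ ⊕ T · R′) (R · Q′ ⊕ T · T′)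
block-· {m} {n} P Q R T P′ Q′ R′ T′ = ≈-block _ _ _ _
  (λ i j → entry (block-₁₁ P Q R T i) (λ c → block-₁₁ P′ Q′ R′ T′ c j) (block-₁₂ P Q R T i) (λ c → block-₂₁ P′ Q′ R′ T′ c j))
  (λ i j → entry (block-₁₁ P Q R T i) (λ c → block-₁₂ P′ Q′ R′ T′ c j) (block-₁₂ P Q R T i) (λ c → block-₂₂ P′ Q′ R′ T′ c j))
  (λ i j → entry (block-₂₁ P Q R T i) (λ c → block-₁₁ P′ Q′ R′ T′ c j) (block-₂₂ P Q R T i) (λ c → block-₂₁ P′ Q′ R′ T′ c j))
  (λ i j → entry (block-₂₁ P Q R T i) (λ c → block-₁₂ P′ Q′ R′ T′ c j) (block-₂₂ P Q R T i) (λ c → block-₂₂ P′ Q′ R′ T′ c j))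
  where
  entry : ∀ {x y} {u₁ v₁ : Fin m → ℚ} {u₂ v₂ : Fin n → ℚ} →
          (∀ c → block P Q R T x (c ↑ˡ n) ≡ u₁ c) → (∀ c → block P′ Q′ R′ T′ (c ↑ˡ n) y ≡ v₁ c) →
          (∀ c → block P Q R T x (m ↑ʳ c) ≡ u₂ c) → (∀ c → block P′ Q′ R′ T′ (m ↑ʳ c) y ≡ v₂ c) →
          (block P Q R T · block P′ Q′ R′ T′) x y ≡ sumF (λ c → u₁ c * v₁ c) + sumF (λ c → u₂ c * v₂ c)
  entry {x} {y} e₁ f₁ e₂ f₂ =
    trans (sumF-↑ {m} (λ c → block P Q R T x c * block P′ Q′ R′ T′ c y))
          (cong₂ _+_ (sumF-cong (λ c → cong₂ _*_ (e₁ c) (f₁ c))) (sumF-cong (λ c → cong₂ _*_ (e₂ c) (f₂ c))))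

-- Schur complements

schurComplement : ∀ {m n} → Mat m m → Mat m n → Mat n m → Mat n n → Mat n n
schurComplement A⁻¹ B C D = D ⊖ C · A⁻¹ · B

schurInverse : ∀ {m n} → Mat m m → Mat m n → Mat n m → Mat n n → Mat (m +ℕ n) (m +ℕ n)
schurInverse A⁻¹ B C S⁻ =
  block (A⁻¹ ⊕ A⁻¹ · B · S⁻ · C · A⁻¹) (neg (A⁻¹ · B · S⁻)) (neg (S⁻ · C · A⁻¹)) S⁻

module SchurComplement {m n : ℕ} (A A⁻¹ : Mat m m) (B : Mat m n) (C : Mat n m) (D S⁻ : Mat n n)
                       (AA⁻¹ : A · A⁻¹ ≈ identity m) (A⁻¹A : A⁻¹ · A ≈ identity m) where

  open ≈-Reasoning

  S : Mat n n
  S = schurComplement A⁻¹ B C D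

  K : Mat n n
  K = C · A⁻¹ · B

  P : Mat n m
  P = S⁻ · C · A⁻¹

  F : Mat n n
  F = S · S⁻

  cancelˡ : ∀ {p} (W : Mat m p) → A · (A⁻¹ · W) ≈ W
  cancelˡ W = begin
    A · (A⁻¹ · W)  ≈⟨ ·-assoc A A⁻¹ W ⟨
    A · A⁻¹ · W    ≈⟨ ·-congʳ W AA⁻¹ ⟩
    identity m · W ≈⟨ ·-identityˡ W ⟩
    W              ∎

  cancelʳ : ∀ {p} (W : Mat p m) → W · A⁻¹ · A ≈ W
  cancelʳ W = begin
    W · A⁻¹ · A    ≈⟨ ·-assoc W A⁻¹ A ⟩
    W · (A⁻¹ · A)  ≈⟨ ·-congˡ W A⁻¹A ⟩
    W · identity m ≈⟨ ·-identityʳ W ⟩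
    W              ∎

  A⁻¹BS⁻CA⁻¹≈A⁻¹[BP] : A⁻¹ · B · S⁻ · C · A⁻¹ ≈ A⁻¹ · (B · P)
  A⁻¹BS⁻CA⁻¹≈A⁻¹[BP] = begin
    A⁻¹ · B · S⁻ · C · A⁻¹       ≈⟨ ·-congʳ A⁻¹ (·-assoc (A⁻¹ · B) S⁻ C) ⟩
    A⁻¹ · B · (S⁻ · C) · A⁻¹     ≈⟨ ·-assoc (A⁻¹ · B) (S⁻ · C) A⁻¹ ⟩
    A⁻¹ · B · P                  ≈⟨ ·-assoc A⁻¹ B P ⟩
    A⁻¹ · (B · P)                ∎

  block-·-schurInverse : block A B C D · schurInverse A⁻¹ B C S⁻ ≈
            block (identity m) (zeros m n) (C · A⁻¹ ⊖ F · C · A⁻¹) F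
  block-·-schurInverse = ≈-trans (block-· A B C D _ _ _ _) (block-cong top-left top-right bottom-left bottom-right)
    where
    top-left : A · (A⁻¹ ⊕ A⁻¹ · B · S⁻ · C · A⁻¹) ⊕ B · neg P ≈ identity m
    top-left = begin
      A · (A⁻¹ ⊕ A⁻¹ · B · S⁻ · C · A⁻¹) ⊕ B · neg P
        ≈⟨ ⊕-cong (·-distribˡ-⊕ A A⁻¹ (A⁻¹ · B · S⁻ · C · A⁻¹)) (≈-sym (neg-distribʳ-· B P)) ⟩
      A · A⁻¹ ⊕ A · (A⁻¹ · B · S⁻ · C · A⁻¹) ⊖ B · P
        ≈⟨ ⊖-congʳ (B · P) (⊕-cong AA⁻¹ (≈-trans (·-congˡ A A⁻¹BS⁻CA⁻¹≈A⁻¹[BP]) (cancelˡ (B · P)))) ⟩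
      identity m ⊕ B · P ⊖ B · P
        ≈⟨ ⊕-⊖-cancelʳ (identity m) (B · P) ⟩
      identity m ∎
    top-right : A · neg (A⁻¹ · B · S⁻) ⊕ B · S⁻ ≈ zeros m n
    top-right = begin
      A · neg (A⁻¹ · B · S⁻) ⊕ B · S⁻    ≈⟨ ⊕-congʳ (B · S⁻) (neg-distribʳ-· A (A⁻¹ · B · S⁻)) ⟨
      neg (A · (A⁻¹ · B · S⁻)) ⊕ B · S⁻  ≈⟨ ⊕-congʳ (B · S⁻) (neg-cong (·-congˡ A (·-assoc A⁻¹ B S⁻))) ⟩
      neg (A · (A⁻¹ · (B · S⁻))) ⊕ B · S⁻ ≈⟨ ⊕-congʳ (B · S⁻) (neg-cong (cancelˡ (B · S⁻))) ⟩
      neg (B · S⁻) ⊕ B · S⁻             ≈⟨ neg-inverseˡ (B · S⁻) ⟩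
      zeros m n                         ∎
    bottom-left : C · (A⁻¹ ⊕ A⁻¹ · B · S⁻ · C · A⁻¹) ⊕ D · neg P ≈ C · A⁻¹ ⊖ F · C · A⁻¹
    bottom-left = begin
      C · (A⁻¹ ⊕ A⁻¹ · B · S⁻ · C · A⁻¹) ⊕ D · neg P
        ≈⟨ ⊕-cong (·-distribˡ-⊕ C A⁻¹ (A⁻¹ · B · S⁻ · C · A⁻¹)) (≈-sym (neg-distribʳ-· D P)) ⟩
      C · A⁻¹ ⊕ C · (A⁻¹ · B · S⁻ · C · A⁻¹) ⊖ D · P
        ≈⟨ ⊖-congʳ (D · P) (⊕-congˡ (C · A⁻¹) C[A⁻¹BS⁻CA⁻¹]≈KP) ⟩
      C · A⁻¹ ⊕ K · P ⊖ D · P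
        ≈⟨ ⊕-⊖-assoc (C · A⁻¹) (K · P) (D · P) ⟩
      C · A⁻¹ ⊖ (D · P ⊖ K · P)
        ≈⟨ ⊖-congˡ (C · A⁻¹) (·-distribʳ-⊖ D K P) ⟨
      C · A⁻¹ ⊖ S · P
        ≈⟨ ⊖-congˡ (C · A⁻¹) SP≈FCA⁻¹ ⟩
      C · A⁻¹ ⊖ F · C · A⁻¹ ∎
      where
      C[A⁻¹BS⁻CA⁻¹]≈KP : C · (A⁻¹ · B · S⁻ · C · A⁻¹) ≈ K · P
      C[A⁻¹BS⁻CA⁻¹]≈KP = begin
        C · (A⁻¹ · B · S⁻ · C · A⁻¹) ≈⟨ ·-congˡ C A⁻¹BS⁻CA⁻¹≈A⁻¹[BP] ⟩
        C · (A⁻¹ · (B · P))          ≈⟨ ·-assoc C A⁻¹ (B · P) ⟨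
        C · A⁻¹ · (B · P)            ≈⟨ ·-assoc (C · A⁻¹) B P ⟨
        K · P                        ∎
      SP≈FCA⁻¹ : S · P ≈ F · C · A⁻¹
      SP≈FCA⁻¹ = begin
        S · (S⁻ · C · A⁻¹)  ≈⟨ ·-assoc S (S⁻ · C) A⁻¹ ⟨
        S · (S⁻ · C) · A⁻¹  ≈⟨ ·-congʳ A⁻¹ (·-assoc S S⁻ C) ⟨
        F · C · A⁻¹         ∎
    bottom-right : C · neg (A⁻¹ · B · S⁻) ⊕ D · S⁻ ≈ F
    bottom-right = begin
      C · neg (A⁻¹ · B · S⁻) ⊕ D · S⁻    ≈⟨ ⊕-congʳ (D · S⁻) (neg-distribʳ-· C (A⁻¹ · B · S⁻)) ⟨
      neg (C · (A⁻¹ · B · S⁻)) ⊕ D · S⁻  ≈⟨ neg-⊕-comm (C · (A⁻¹ · B · S⁻)) (D · S⁻) ⟩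
      D · S⁻ ⊖ C · (A⁻¹ · B · S⁻)        ≈⟨ ⊖-congˡ (D · S⁻) C[A⁻¹BS⁻]≈KS⁻ ⟩
      D · S⁻ ⊖ K · S⁻                   ≈⟨ ·-distribʳ-⊖ D K S⁻ ⟨
      F                                 ∎
      where
      C[A⁻¹BS⁻]≈KS⁻ : C · (A⁻¹ · B · S⁻) ≈ K · S⁻
      C[A⁻¹BS⁻]≈KS⁻ = begin
        C · (A⁻¹ · B · S⁻)  ≈⟨ ·-assoc C (A⁻¹ · B) S⁻ ⟨
        C · (A⁻¹ · B) · S⁻  ≈⟨ ·-congʳ S⁻ (·-assoc C A⁻¹ B) ⟨
        K · S⁻              ∎

  schurInverse-is-1-inverse : S · S⁻ · S ≈ S →
               block A B C D · schurInverse A⁻¹ B C S⁻ · block A B C D ≈ block A B C D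
  schurInverse-is-1-inverse SS⁻S = begin
    block A B C D · schurInverse A⁻¹ B C S⁻ · block A B C D
      ≈⟨ ·-congʳ (block A B C D) block-·-schurInverse ⟩
    block (identity m) (zeros m n) E F · block A B C D
      ≈⟨ block-· (identity m) (zeros m n) E F A B C D ⟩
    block (identity m · A ⊕ zeros m n · C) (identity m · B ⊕ zeros m n · D) (E · A ⊕ F · C) (E · B ⊕ F · D)
      ≈⟨ block-cong top-left top-right bottom-left bottom-right ⟩
    block A B C D ∎
    where
    E : Mat n m
    E = C · A⁻¹ ⊖ F · C · A⁻¹
    top-left : identity m · A ⊕ zeros m n · C ≈ A
    top-left = ≈-trans (⊕-cong (·-identityˡ A) (·-zeroˡ C)) (⊕-identityʳ A)
    top-right : identity m · B ⊕ zeros m n · D ≈ B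
    top-right = ≈-trans (⊕-cong (·-identityˡ B) (·-zeroˡ D)) (⊕-identityʳ B)
    bottom-left : E · A ⊕ F · C ≈ C
    bottom-left = begin
      E · A ⊕ F · C                        ≈⟨ ⊕-congʳ (F · C) (·-distribʳ-⊖ (C · A⁻¹) (F · C · A⁻¹) A) ⟩
      C · A⁻¹ · A ⊖ F · C · A⁻¹ · A ⊕ F · C ≈⟨ ⊕-congʳ (F · C) (⊖-cong (cancelʳ C) (cancelʳ (F · C))) ⟩
      C ⊖ F · C ⊕ F · C                    ≈⟨ ⊖-⊕-cancelʳ C (F · C) ⟩
      C                                    ∎
    bottom-right : E · B ⊕ F · D ≈ D
    bottom-right = begin
      E · B ⊕ F · D                   ≈⟨ ⊕-congʳ (F · D) (·-distribʳ-⊖ (C · A⁻¹) (F · C · A⁻¹) B) ⟩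
      K ⊖ F · C · A⁻¹ · B ⊕ F · D     ≈⟨ ⊕-congʳ (F · D) (⊖-congˡ K FCA⁻¹B≈FK) ⟩
      K ⊖ F · K ⊕ F · D               ≈⟨ ⊖-⊕-assoc K (F · K) (F · D) ⟩
      K ⊕ (F · D ⊖ F · K)             ≈⟨ ⊕-congˡ K (·-distribˡ-⊖ F D K) ⟨
      K ⊕ F · S                       ≈⟨ ⊕-congˡ K SS⁻S ⟩
      K ⊕ S                           ≈⟨ ⊕-⊖-cancelˡ K D ⟩
      D                               ∎
      where
      FCA⁻¹B≈FK : F · C · A⁻¹ · B ≈ F · K
      FCA⁻¹B≈FK = begin
        F · C · A⁻¹ · B    ≈⟨ ·-congʳ B (·-assoc F C A⁻¹) ⟩
        F · (C · A⁻¹) · B  ≈⟨ ·-assoc F (C · A⁻¹) B ⟩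
        F · K              ∎

-- Symmetry and group inverses

transpose-·-· : ∀ {m n p q} (X : Mat m n) (Y : Mat n p) (Z : Mat p q) →
                transpose (X · Y · Z) ≈ transpose Z · transpose Y · transpose X
transpose-·-· X Y Z = begin
  transpose (X · Y · Z)                      ≈⟨ transpose-· (X · Y) Z ⟩
  transpose Z · transpose (X · Y)            ≈⟨ ·-congˡ (transpose Z) (transpose-· X Y) ⟩
  transpose Z · (transpose Y · transpose X)  ≈⟨ ·-assoc (transpose Z) (transpose Y) (transpose X) ⟨
  transpose Z · transpose Y · transpose X    ∎
  where open ≈-Reasoning

inverse-symmetric : ∀ {n} {A A⁻¹ : Mat n n} → Symmetric A → A · A⁻¹ ≈ identity n → Symmetric A⁻¹
inverse-symmetric {n} {A} {A⁻¹} symA AA⁻¹ = ≈-sym (begin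
  transpose A⁻¹                       ≈⟨ ·-identityʳ (transpose A⁻¹) ⟨
  transpose A⁻¹ · identity n          ≈⟨ ·-congˡ (transpose A⁻¹) AA⁻¹ ⟨
  transpose A⁻¹ · (A · A⁻¹)           ≈⟨ ·-assoc (transpose A⁻¹) A A⁻¹ ⟨
  transpose A⁻¹ · A · A⁻¹             ≈⟨ ·-congʳ A⁻¹ (·-congˡ (transpose A⁻¹) symA) ⟩
  transpose A⁻¹ · transpose A · A⁻¹   ≈⟨ ·-congʳ A⁻¹ (transpose-· A A⁻¹) ⟨
  transpose (A · A⁻¹) · A⁻¹           ≈⟨ ·-congʳ A⁻¹ (λ i j → AA⁻¹ j i) ⟩
  transpose (identity n) · A⁻¹        ≈⟨ ·-congʳ A⁻¹ (transpose-identity n) ⟩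
  identity n · A⁻¹                    ≈⟨ ·-identityˡ A⁻¹ ⟩
  A⁻¹                                 ∎)
  where open ≈-Reasoning

groupInverse-unique : ∀ {n} {S X Y : Mat n n} → IsGroupInverse X S → IsGroupInverse Y S → X ≈ Y
groupInverse-unique {S = S} {X} {Y} (SXS , XSX , SX≈XS) (SYS , YSY , SY≈YS) = begin
  X           ≈⟨ XSX ⟨
  X · S · X   ≈⟨ ·-congʳ X XS≈YS ⟩
  Y · S · X   ≈⟨ ·-assoc Y S X ⟩
  Y · (S · X) ≈⟨ ·-congˡ Y (≈-trans SX≈XS XS≈YS) ⟩
  Y · (Y · S) ≈⟨ ·-congˡ Y SY≈YS ⟨
  Y · (S · Y) ≈⟨ ·-assoc Y S Y ⟨
  Y · S · Y   ≈⟨ YSY ⟩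
  Y           ∎
  where
  open ≈-Reasoning
  XS≈YS : X · S ≈ Y · S
  XS≈YS = begin
    X · S               ≈⟨ SX≈XS ⟨
    S · X               ≈⟨ ·-congʳ X SYS ⟨
    S · Y · S · X       ≈⟨ ·-assoc (S · Y) S X ⟩
    S · Y · (S · X)     ≈⟨ ·-cong SY≈YS SX≈XS ⟩
    Y · S · (X · S)     ≈⟨ ·-assoc Y S (X · S) ⟩
    Y · (S · (X · S))   ≈⟨ ·-congˡ Y (·-assoc S X S) ⟨
    Y · (S · X · S)     ≈⟨ ·-congˡ Y SXS ⟩
    Y · S               ∎

groupInverse-resp-≈ : ∀ {n} {S S′ X : Mat n n} → S ≈ S′ → IsGroupInverse X S → IsGroupInverse X S′
groupInverse-resp-≈ {X = X} S≈S′ (SXS , XSX , SX≈XS) =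
  ≈-trans (·-cong (·-congʳ X (≈-sym S≈S′)) (≈-sym S≈S′)) (≈-trans SXS S≈S′) ,
  ≈-trans (·-congʳ X (·-congˡ X (≈-sym S≈S′))) XSX ,
  ≈-trans (·-congʳ X (≈-sym S≈S′)) (≈-trans SX≈XS (·-congˡ X S≈S′))

transpose-groupInverse : ∀ {n} {S X : Mat n n} → IsGroupInverse X S → IsGroupInverse (transpose X) (transpose S)
transpose-groupInverse {S = S} {X} (SXS , XSX , SX≈XS) =
  ≈-trans (≈-sym (transpose-·-· S X S)) (λ i j → SXS j i) ,
  ≈-trans (≈-sym (transpose-·-· X S X)) (λ i j → XSX j i) ,
  ≈-trans (≈-sym (transpose-· X S)) (≈-trans (λ i j → sym (SX≈XS j i)) (transpose-· S X))

groupInverse-symmetric : ∀ {n} {S X : Mat n n} → Symmetric S → IsGroupInverse X S → Symmetric X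
groupInverse-symmetric symS gi = groupInverse-unique gi (groupInverse-resp-≈ (≈-sym symS) (transpose-groupInverse gi))

schurInverse-symmetric : ∀ {m n} {A⁻¹ : Mat m m} (B : Mat m n) {S⁻ : Mat n n} →
                         Symmetric A⁻¹ → Symmetric S⁻ → Symmetric (schurInverse A⁻¹ B (transpose B) S⁻)
schurInverse-symmetric {A⁻¹ = A⁻¹} B {S⁻} symA symS =
  ≈-trans (block-cong (⊕-cong symA symX) (neg-cong (λ i j → Qᵀ j i)) (neg-cong (≈-sym Qᵀ)) symS)
          (≈-sym (transpose-block (A⁻¹ ⊕ A⁻¹ · B · S⁻ · transpose B · A⁻¹) (neg (A⁻¹ · B · S⁻)) (neg (S⁻ · transpose B · A⁻¹)) S⁻))
  where
  open ≈-Reasoning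
  Qᵀ : transpose (A⁻¹ · B · S⁻) ≈ S⁻ · transpose B · A⁻¹
  Qᵀ = ≈-trans (transpose-·-· A⁻¹ B S⁻) (·-cong (·-congʳ (transpose B) (≈-sym symS)) (≈-sym symA))
  symX : Symmetric (A⁻¹ · B · S⁻ · transpose B · A⁻¹)
  symX = ≈-sym (begin
    transpose (A⁻¹ · B · S⁻ · transpose B · A⁻¹)     ≈⟨ transpose-·-· (A⁻¹ · B · S⁻) (transpose B) A⁻¹ ⟩
    transpose A⁻¹ · B · transpose (A⁻¹ · B · S⁻)     ≈⟨ ·-cong (·-congʳ B (≈-sym symA)) Qᵀ ⟩
    A⁻¹ · B · (S⁻ · transpose B · A⁻¹)               ≈⟨ ·-assoc (A⁻¹ · B) (S⁻ · transpose B) A⁻¹ ⟨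
    A⁻¹ · B · (S⁻ · transpose B) · A⁻¹               ≈⟨ ·-congʳ A⁻¹ (·-assoc (A⁻¹ · B) S⁻ (transpose B)) ⟨
    A⁻¹ · B · S⁻ · transpose B · A⁻¹                 ∎)

-- Laplacians and Kronecker products

fromBool-if : ∀ b → fromBool b ≡ (if b then 1ℚ else 0ℚ)
fromBool-if true  = refl
fromBool-if false = refl

fromBool-∧ : ∀ b c → fromBool (b ∧ c) ≡ fromBool b * fromBool c
fromBool-∧ true  c = sym (*-identityˡ (fromBool c))
fromBool-∧ false c = sym (*-zeroˡ (fromBool c))

natℚ-count : ∀ {n} (f : Fin n → Bool) → natℚ (count f) ≡ sumF (fromBool ∘ f)
natℚ-count {zero}  f = refl
natℚ-count {suc n} f with f zero
... | true  = cong (1ℚ +_) (natℚ-count (f ∘ suc))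
... | false = trans (natℚ-count (f ∘ suc)) (sym (+-identityˡ _))

sumF-one : ∀ n → sumF {n} (λ _ → 1ℚ) ≡ natℚ n
sumF-one zero    = refl
sumF-one (suc n) = cong (1ℚ +_) (sumF-one n)

sumF-fromBool-≟ : ∀ {n} (i : Fin n) (c : ℚ) → sumF (λ k → fromBool (does (i ≟ k)) * c) ≡ c
sumF-fromBool-≟ i c = trans (sumF-cong (λ k → cong (_* c) (fromBool-if (does (i ≟ k))))) (sumF-identityˡ i (λ _ → c))

↑ˡ≢↑ʳ : ∀ {m n} (i : Fin m) (j : Fin n) → i ↑ˡ n ≢ m ↑ʳ j
↑ˡ≢↑ʳ {m} {n} i j e with trans (sym (splitAt-↑ˡ m i n)) (trans (cong (splitAt m) e) (splitAt-↑ʳ m n j))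
... | ()

⊗-combine : ∀ {a b c d} (A : Mat a b) (B : Mat c d) j i l k →
            (A ⊗ B) (combine j i) (combine l k) ≡ A j l * B i k
⊗-combine {a} {b} {c} {d} A B j i l k =
  cong₂ (λ p q → A (proj₁ p) (proj₁ q) * B (proj₂ p) (proj₂ q)) (remQuot-combine {a} {c} j i) (remQuot-combine {b} {d} l k)

⊗ʳ-combine : ∀ {b c d} (u : Fin b → ℚ) (B : Mat c d) k l i → (u ⊗ʳ B) k (combine l i) ≡ u l * B k i
⊗ʳ-combine {b} {c} {d} u B k l i = cong (λ p → u (proj₁ p) * B k (proj₂ p)) (remQuot-combine {b} {d} l i)

⊗-symmetric : ∀ {a c} {A : Mat a a} {B : Mat c c} → Symmetric A → Symmetric B → Symmetric (A ⊗ B)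
⊗-symmetric {a} {c} {A} {B} symA symB = combine-elim (λ j i → combine-elim (λ l k → begin
  (A ⊗ B) (combine j i) (combine l k) ≡⟨ ⊗-combine A B j i l k ⟩
  A j l * B i k                       ≡⟨ cong₂ _*_ (symA j l) (symB i k) ⟩
  A l j * B k i                       ≡⟨ ⊗-combine A B l k j i ⟨
  (A ⊗ B) (combine l k) (combine j i) ∎))
  where open ≡-Reasoning

laplacian-symmetric : ∀ {n} (G : Graph n) → Symmetric (laplacian G)
laplacian-symmetric G i j with i ≟ j | j ≟ i
... | yes refl | yes _   = refl
... | yes refl | no i≢i  = ⊥-elim (i≢i refl)
... | no i≢j   | yes refl = ⊥-elim (i≢j refl)
... | no _     | no _    = cong (λ b → 0ℚ + - fromBool b) (Graph.sym G i j)

loopless : ∀ {n} (G : Graph n) i j → does (i ≟ j) ≡ true → adj G i j ≡ false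
loopless G i j with i ≟ j
... | yes refl = λ _ → irrefl G i
... | no _     = λ ()

lapRel-entry : ∀ {n} (a : Fin n → Fin n → Bool) {x y : Fin n} {b : Bool} {d : ℚ} {e : Bool} →
               does (x ≟ y) ≡ b → natℚ (count (a x)) ≡ d → a x y ≡ e →
               lapRel a x y ≡ (if b then d else 0ℚ) + - fromBool e
lapRel-entry a refl refl refl = refl

if-+-distrib : ∀ b (d c e : ℚ) →
  (if b then d + c else 0ℚ) + - e ≡ (if b then d else 0ℚ) + - e + c * (if b then 1ℚ else 0ℚ)
if-+-distrib true  d c e = solve 3 (λ d c e → d :+ c :- e := d :- e :+ c :* con 1ℚ) refl d c e
if-+-distrib false d c e = solve 2 (λ c e → con 0ℚ :- e := con 0ℚ :- e :+ c :* con 0ℚ) refl c e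

-- The entry of L(G₁ ∘ G₂) at (w^i_j, w^{i′}_{j′}) for b = [j = j′], c = [i = i′] and a = [j ∼ j′];
-- the side condition is looplessness of G₂.
copy-laplacian-entry : ∀ b c a (d : ℚ) → (b ≡ true → a ≡ false) →
  (if b ∧ c then 1ℚ + d else 0ℚ) + - fromBool (c ∧ a) ≡
  ((if b then d else 0ℚ) + - fromBool a + (if b then 1ℚ else 0ℚ)) * (if c then 1ℚ else 0ℚ)
copy-laplacian-entry true  true  a d b⇒¬a rewrite b⇒¬a refl =
  solve 1 (λ d → con 1ℚ :+ d :- con 0ℚ := (d :- con 0ℚ :+ con 1ℚ) :* con 1ℚ) refl d
copy-laplacian-entry true  false a d _ =
  solve 2 (λ d x → con 0ℚ :- con 0ℚ := (d :- x :+ con 1ℚ) :* con 0ℚ) refl d (fromBool a)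
copy-laplacian-entry false true  a d _ =
  solve 1 (λ x → con 0ℚ :- x := (con 0ℚ :- x :+ con 0ℚ) :* con 1ℚ) refl (fromBool a)
copy-laplacian-entry false false a d _ =
  solve 1 (λ x → con 0ℚ :- con 0ℚ := (con 0ℚ :- x :+ con 0ℚ) :* con 0ℚ) refl (fromBool a)

neg-ones-⊗ʳ-identity : ∀ {k n} (i : Fin n) (j′ : Fin k) (i′ : Fin n) →
                       neg (onesVec k ⊗ʳ identity n) i (combine j′ i′) ≡ - identity n i i′
neg-ones-⊗ʳ-identity {k} {n} i j′ i′ =
  cong -_ (trans (⊗ʳ-combine (onesVec k) (identity n) i j′ i′) (*-identityˡ (identity n i i′)))

ones-⊗-sandwich : ∀ {k n} (A : Mat n n) →
  transpose (neg (onesVec k ⊗ʳ identity n)) · A · neg (onesVec k ⊗ʳ identity n) ≈ ones k k ⊗ A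
ones-⊗-sandwich {k} {n} A = combine-elim (λ j i → combine-elim (λ l i′ → begin
  sumF (λ b → (Uᵀ · A) (combine j i) b * U b (combine l i′))  ≡⟨ sumF-cong (λ b → cong₂ _*_ (row j i b) (neg-ones-⊗ʳ-identity b l i′)) ⟩
  sumF (λ b → - A i b * - identity n b i′)                   ≡⟨ sumF-cong (λ b → solve 2 (λ x y → :- x :* :- y := x :* y) refl (A i b) _) ⟩
  sumF (λ b → A i b * identity n b i′)                       ≡⟨ sumF-identityʳ i′ (A i) ⟩
  A i i′                                                     ≡⟨ *-identityˡ (A i i′) ⟨
  1ℚ * A i i′                                                ≡⟨ ⊗-combine (ones k k) A j i l i′ ⟨
  (ones k k ⊗ A) (combine j i) (combine l i′)                ∎))
  where
  open ≡-Reasoning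
  U : Mat n (k *ℕ n)
  U = neg (onesVec k ⊗ʳ identity n)
  Uᵀ : Mat (k *ℕ n) n
  Uᵀ = transpose U
  row : ∀ j i b → (Uᵀ · A) (combine j i) b ≡ - A i b
  row j i b = begin
    sumF (λ a → U a (combine j i) * A a b)    ≡⟨ sumF-cong (λ a → cong (_* A a b) (trans (neg-ones-⊗ʳ-identity a j i) (cong -_ (identity-sym a i)))) ⟩
    sumF (λ a → - identity n i a * A a b)     ≡⟨ sumF-cong (λ a → neg-distribˡ-* (identity n i a) (A a b)) ⟨
    sumF (λ a → - (identity n i a * A a b))   ≡⟨ neg-distrib-sumF (λ a → identity n i a * A a b) ⟨
    - sumF (λ a → identity n i a * A a b)     ≡⟨ cong -_ (sumF-identityˡ i (λ a → A a b)) ⟩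
    - A i b                                   ∎

-- The Laplacian of the corona

module Corona {n₁ n₂ : ℕ} (G₁ : Graph n₁) (G₂ : Graph n₂) where

  N : ℕ
  N = n₂ *ℕ n₁

  L₁ : Mat n₁ n₁
  L₁ = laplacian G₁ ⊕ scal (natℚ n₂) (identity n₁)

  L₂ : Mat n₁ N
  L₂ = neg (onesVec n₂ ⊗ʳ identity n₁)

  L₃ : Mat N N
  L₃ = (laplacian G₂ ⊕ identity n₂) ⊗ identity n₁

  L₁-symmetric : Symmetric L₁
  L₁-symmetric = ⊕-cong (laplacian-symmetric G₁) (λ i j → cong (natℚ n₂ *_) (identity-sym i j))

  L₃-symmetric : Symmetric L₃
  L₃-symmetric = ⊗-symmetric {A = laplacian G₂ ⊕ identity n₂}
                   (⊕-cong (laplacian-symmetric G₂) identity-sym) identity-sym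

  R : Fin (n₁ +ℕ N) → Fin (n₁ +ℕ N) → Bool
  R = coronaRel G₁ G₂

  v : Fin n₁ → Fin (n₁ +ℕ N)
  v i = i ↑ˡ N

  w : Fin n₂ → Fin n₁ → Fin (n₁ +ℕ N)
  w j i = n₁ ↑ʳ combine {n₂} {n₁} j i

  decode-v : ∀ i → decode {n₁} {n₂} (v i) ≡ vtx i
  decode-v i rewrite splitAt-↑ˡ n₁ i N = refl

  decode-w : ∀ j i → decode {n₁} {n₂} (w j i) ≡ wtx j i
  decode-w j i rewrite splitAt-↑ʳ n₁ N (combine j i) =
    cong (λ p → wtx (proj₁ p) (proj₂ p)) (remQuot-combine {n₂} {n₁} j i)

  R-vv : ∀ i i′ → R (v i) (v i′) ≡ adj G₁ i i′
  R-vv i i′ = cong₂ (coronaAdj G₁ G₂) (decode-v i) (decode-v i′)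

  R-vw : ∀ i j′ i′ → R (v i) (w j′ i′) ≡ does (i ≟ i′)
  R-vw i j′ i′ = cong₂ (coronaAdj G₁ G₂) (decode-v i) (decode-w j′ i′)

  R-wv : ∀ j i i′ → R (w j i) (v i′) ≡ does (i ≟ i′)
  R-wv j i i′ = cong₂ (coronaAdj G₁ G₂) (decode-w j i) (decode-v i′)

  R-ww : ∀ j i j′ i′ → R (w j i) (w j′ i′) ≡ does (i ≟ i′) ∧ adj G₂ j j′
  R-ww j i j′ i′ = cong₂ (coronaAdj G₁ G₂) (decode-w j i) (decode-w j′ i′)

  degree-split : ∀ x → natℚ (count (R x)) ≡
    sumF (λ i′ → fromBool (R x (v i′))) + sumF (λ j′ → sumF (λ i′ → fromBool (R x (w j′ i′))))
  degree-split x = begin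
    natℚ (count (R x))                              ≡⟨ natℚ-count (R x) ⟩
    sumF (fromBool ∘ R x)                           ≡⟨ sumF-↑ {n₁} (fromBool ∘ R x) ⟩
    sumF (λ i′ → fromBool (R x (v i′))) + sumF (λ y → fromBool (R x (n₁ ↑ʳ y)))
      ≡⟨ cong (sumF (λ i′ → fromBool (R x (v i′))) +_) (sumF-combine {n₂} {n₁} (λ y → fromBool (R x (n₁ ↑ʳ y)))) ⟩
    sumF (λ i′ → fromBool (R x (v i′))) + sumF (λ j′ → sumF (λ i′ → fromBool (R x (w j′ i′)))) ∎
    where open ≡-Reasoning

  degree-v : ∀ i → natℚ (count (R (v i))) ≡ natℚ (degree G₁ i) + natℚ n₂
  degree-v i = trans (degree-split (v i)) (cong₂ _+_
    (trans (sumF-cong (λ i′ → cong fromBool (R-vv i i′))) (sym (natℚ-count (adj G₁ i))))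
    (trans (sumF-cong (λ j′ → trans (sumF-cong (λ i′ → trans (cong fromBool (R-vw i j′ i′)) (sym (*-identityʳ _))))
                                    (sumF-fromBool-≟ i 1ℚ)))
           (sumF-one n₂)))

  degree-w : ∀ j i → natℚ (count (R (w j i))) ≡ 1ℚ + natℚ (degree G₂ j)
  degree-w j i = trans (degree-split (w j i)) (cong₂ _+_
    (trans (sumF-cong (λ i′ → trans (cong fromBool (R-wv j i i′)) (sym (*-identityʳ _)))) (sumF-fromBool-≟ i 1ℚ))
    (trans (sumF-cong (λ j′ → trans (sumF-cong (λ i′ → trans (cong fromBool (R-ww j i j′ i′)) (fromBool-∧ (does (i ≟ i′)) _)))
                                    (sumF-fromBool-≟ i (fromBool (adj G₂ j j′)))))
           (sym (natℚ-count (adj G₂ j)))))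

  does-vv : ∀ i i′ → does (v i ≟ v i′) ≡ does (i ≟ i′)
  does-vv i i′ = does-⇔ (mk⇔ (↑ˡ-injective N i i′) (cong v)) (v i ≟ v i′) (i ≟ i′)

  does-vw : ∀ i j′ i′ → does (v i ≟ w j′ i′) ≡ false
  does-vw i j′ i′ = dec-false (v i ≟ w j′ i′) (↑ˡ≢↑ʳ i (combine j′ i′))

  does-wv : ∀ j i i′ → does (w j i ≟ v i′) ≡ false
  does-wv j i i′ = dec-false (w j i ≟ v i′) (↑ˡ≢↑ʳ i′ (combine j i) ∘ sym)

  does-ww : ∀ j i j′ i′ → does (w j i ≟ w j′ i′) ≡ does (j ≟ j′) ∧ does (i ≟ i′)
  does-ww j i j′ i′ = does-⇔ (mk⇔ (combine-injective j i j′ i′ ∘ ↑ʳ-injective n₁ (combine j i) (combine j′ i′))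
                                  (λ { (refl , refl) → refl }))
                             (w j i ≟ w j′ i′) ((j ≟ j′) ×-dec (i ≟ i′))

  coronaLaplacian-block : coronaLaplacian G₁ G₂ ≈ block L₁ L₂ (transpose L₂) L₃
  coronaLaplacian-block = ≈-block L₁ L₂ (transpose L₂) L₃
    vv
    (λ i → combine-elim {P = λ y → coronaLaplacian G₁ G₂ (v i) (n₁ ↑ʳ y) ≡ L₂ i y} (vw i))
    (λ y i′ → combine-elim {P = λ y → coronaLaplacian G₁ G₂ (n₁ ↑ʳ y) (v i′) ≡ L₂ i′ y} (λ j i → wv j i i′) y)
    (λ y y′ → combine-elim {P = λ y → coronaLaplacian G₁ G₂ (n₁ ↑ʳ y) (n₁ ↑ʳ y′) ≡ L₃ y y′}
                (λ j i → combine-elim {P = λ y′ → coronaLaplacian G₁ G₂ (w j i) (n₁ ↑ʳ y′) ≡ L₃ (combine j i) y′}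
                           (ww j i) y′) y)
    where
    vv : ∀ i i′ → coronaLaplacian G₁ G₂ (v i) (v i′) ≡ L₁ i i′
    vv i i′ = trans (lapRel-entry R (does-vv i i′) (degree-v i) (R-vv i i′))
                    (if-+-distrib (does (i ≟ i′)) _ _ _)
    vw : ∀ i j′ i′ → coronaLaplacian G₁ G₂ (v i) (w j′ i′) ≡ L₂ i (combine j′ i′)
    vw i j′ i′ = begin
      coronaLaplacian G₁ G₂ (v i) (w j′ i′)  ≡⟨ lapRel-entry R (does-vw i j′ i′) refl (R-vw i j′ i′) ⟩
      0ℚ + - fromBool (does (i ≟ i′))        ≡⟨ +-identityˡ _ ⟩
      - fromBool (does (i ≟ i′))             ≡⟨ cong -_ (fromBool-if (does (i ≟ i′))) ⟩
      - identity n₁ i i′                     ≡⟨ neg-ones-⊗ʳ-identity i j′ i′ ⟨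
      L₂ i (combine j′ i′)                   ∎
      where open ≡-Reasoning
    wv : ∀ j i i′ → coronaLaplacian G₁ G₂ (w j i) (v i′) ≡ L₂ i′ (combine j i)
    wv j i i′ = begin
      coronaLaplacian G₁ G₂ (w j i) (v i′)   ≡⟨ lapRel-entry R (does-wv j i i′) refl (R-wv j i i′) ⟩
      0ℚ + - fromBool (does (i ≟ i′))        ≡⟨ +-identityˡ _ ⟩
      - fromBool (does (i ≟ i′))             ≡⟨ cong -_ (fromBool-if (does (i ≟ i′))) ⟩
      - identity n₁ i i′                     ≡⟨ cong -_ (identity-sym i i′) ⟩
      - identity n₁ i′ i                     ≡⟨ neg-ones-⊗ʳ-identity i′ j i ⟨
      L₂ i′ (combine j i)                    ∎
      where open ≡-Reasoning
    ww : ∀ j i j′ i′ → coronaLaplacian G₁ G₂ (w j i) (w j′ i′) ≡ L₃ (combine j i) (combine j′ i′)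
    ww j i j′ i′ =
      trans (lapRel-entry R (does-ww j i j′ i′) (degree-w j i) (R-ww j i j′ i′))
      (trans (copy-laplacian-entry (does (j ≟ j′)) (does (i ≟ i′)) (adj G₂ j j′) (natℚ (degree G₂ j)) (loopless G₂ j j′))
             (sym (⊗-combine (laplacian G₂ ⊕ identity n₂) (identity n₁) j i j′ i′)))

theorem3p1 : (n₁ n₂ r₁ m₁ : ℕ) → 1 ≤ n₂ →
    (G₁ : Graph n₁) → (G₂ : Graph n₂) →
    Regular G₁ r₁ → numEdges G₁ ≡ m₁ →
    (L₁inv : Mat n₁ n₁) → IsInverse L₁inv (laplacian G₁ ⊕ scal (natℚ n₂) (identity n₁)) →
    (S♯ : Mat (n₂ *ℕ n₁) (n₂ *ℕ n₁)) →
    IsGroupInverse S♯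
      (((laplacian G₂ ⊕ identity n₂) ⊗ identity n₁) ⊖ (ones n₂ n₂ ⊗ L₁inv)) →
    let L₂ : Mat n₁ (n₂ *ℕ n₁)
        L₂ = neg (onesVec n₂ ⊗ʳ identity n₁)
        M  = block (L₁inv ⊕ (L₁inv · L₂ · S♯ · transpose L₂ · L₁inv))
                   (neg (L₁inv · L₂ · S♯))
                   (neg (S♯ · transpose L₂ · L₁inv))
                   S♯
    in Symmetric M × Is1Inverse M (coronaLaplacian G₁ G₂)
theorem3p1 n₁ n₂ _ _ _ G₁ G₂ _ _ L₁⁻¹ (L₁L₁⁻¹ , L₁⁻¹L₁) S♯ S♯-groupInverse =
  schurInverse-symmetric L₂ L₁⁻¹-symmetric S♯-symmetric , corona-1-inverse
  where
  open Corona G₁ G₂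
  open SchurComplement L₁ L₁⁻¹ L₂ (transpose L₂) L₃ S♯ L₁L₁⁻¹ L₁⁻¹L₁
  open ≈-Reasoning

  L₁⁻¹-symmetric : Symmetric L₁⁻¹
  L₁⁻¹-symmetric = inverse-symmetric L₁-symmetric L₁L₁⁻¹

  S♯-symmetric : Symmetric S♯
  S♯-symmetric = groupInverse-symmetric
    (⊖-cong L₃-symmetric (⊗-symmetric {A = ones n₂ n₂} (λ _ _ → refl) L₁⁻¹-symmetric)) S♯-groupInverse

  SS♯S : S · S♯ · S ≈ S
  SS♯S = proj₁ (groupInverse-resp-≈ (⊖-congˡ L₃ (≈-sym (ones-⊗-sandwich {n₂} L₁⁻¹))) S♯-groupInverse)

  corona-1-inverse : coronaLaplacian G₁ G₂ · schurInverse L₁⁻¹ L₂ (transpose L₂) S♯ · coronaLaplacian G₁ G₂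
                     ≈ coronaLaplacian G₁ G₂
  corona-1-inverse = begin
    coronaLaplacian G₁ G₂ · schurInverse L₁⁻¹ L₂ (transpose L₂) S♯ · coronaLaplacian G₁ G₂
      ≈⟨ ·-cong (·-congʳ (schurInverse L₁⁻¹ L₂ (transpose L₂) S♯) coronaLaplacian-block) coronaLaplacian-block ⟩
    block L₁ L₂ (transpose L₂) L₃ · schurInverse L₁⁻¹ L₂ (transpose L₂) S♯ · block L₁ L₂ (transpose L₂) L₃
      ≈⟨ schurInverse-is-1-inverse SS♯S ⟩
    block L₁ L₂ (transpose L₂) L₃
      ≈⟨ coronaLaplacian-block ⟨
    coronaLaplacian G₁ G₂ ∎
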